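{- If a graph has linear cliquewidth at most $k$, then it is (up to isomorphism, with colors ignored) the underlying graph of some $k$-derivation $\sigma\in S_k$.
   Context: Graphs are finite, simple, undirected. A $k$-colored graph assigns each vertex a color in $[k]$. Linear cliquewidth of a graph: least $k$ such that the graph is obtained from the empty graph by a sequence of operations, each either Recolor$_\phi$ ($\phi\colon[k]\to[k]$; replace each color $i$ by $\phi(i)$) or Add Vertex$_{i,X}$ ($i\in[k]$, $X\subseteq[k]$; add a new vertex of color $i$ adjacent exactly to existing vertices with colors in $X$). A $k$-derivation is a triple $\sigma=(G,\lambda,\phi)$ where $G$ is a $k$-colored graph (the underlying graph), $\lambda\colon V(G)\to 2^{[k]}$ assigns to each vertex its profile, and $\phi\colon[k]\to[k]$ is the recoloring. The composition of $\sigma_1=(G_1,\lambda_1,\phi_1)$ and $\sigma_2=(G_2,\lambda_2,\phi_2)$ is $\sigma_1\cdot\sigma_2=(G,\lambda,\phi_2\circ\phi_1)$ where $G$ is the disjoint union of $\phi_2(G_1)$ ($G_1$ with each color $i$ replaced by $\phi_2(i)$) and $G_2$, plus an edge between $u\in V(G_1)$ and $v\in V(G_2)$ whenever the color of $u$ in $G_1$ belongs to $\lambda_2(v)$; and $\lambda(u)=\lambda_1(u)$ for $u\in V(G_1)$, $\lambda(u)=\phi_1^{ -1}(\lambda_2(u))$ for $u\in V(G_2)$. This composition is associative. A $k$-derivation is atomic if its underlying graph has at most one vertex. $S_k$ is the semigroup of $k$-derivations generated by the atomic $k$-derivations under composition. -}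

module Defs where

open import Data.Nat using (ℕ; zero; suc; _+_; _≤_)
open import Data.Fin using (Fin; zero; suc; splitAt)
open import Data.Fin.Subset using (Subset)
open import Data.Bool using (Bool; true; false)
open import Data.Vec using (lookup; tabulate)
open import Data.Sum using (_⊎_; inj₁; inj₂)
open import Data.Product using (Σ; ∃; ∃-syntax; _×_; _,_)
open import Data.List using (List; []; _∷_; foldl)
open import Function using (_∘_)
open import Function.Bundles using (_⤖_; Bijection)
open import Relation.Binary.PropositionalEquality using (_≡_; refl)

record Graph : Set where
  field
    size    : ℕ
    adj     : Fin size → Fin size → Bool
    adj-sym : ∀ u v → adj u v ≡ adj v u
    adj-irr : ∀ u → adj u u ≡ false
open Graph public

_≅_ : Graph → Graph → Set
G ≅ H = Σ (Fin (size G) ⤖ Fin (size H)) λ f →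
          ∀ u v → adj H (Bijection.to f u) (Bijection.to f v) ≡ adj G u v

record CGraph (k : ℕ) : Set where
  field
    graph : Graph
    color : Fin (size graph) → Fin k
open CGraph public

data Op (k : ℕ) : Set where
  recolor  : (Fin k → Fin k) → Op k
  addVertex : Fin k → Subset k → Op k

emptyGraph : Graph
emptyGraph = record { size = 0 ; adj = λ () ; adj-sym = λ () ; adj-irr = λ () }

emptyC : ∀ {k} → CGraph k
emptyC = record { graph = emptyGraph ; color = λ () }


-- Adding a vertex: the new vertex is vertex zero of Fin (suc n).
addAdj : ∀ {k n} → (Fin n → Fin n → Bool) → (Fin n → Fin k) → Subset k →
         Fin (suc n) → Fin (suc n) → Bool
addAdj a c X zero    zero    = false
addAdj a c X zero    (suc v) = lookup X (c v)
addAdj a c X (suc u) zero    = lookup X (c u)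
addAdj a c X (suc u) (suc v) = a u v

addAdj-sym : ∀ {k n} (a : Fin n → Fin n → Bool) (c : Fin n → Fin k) (X : Subset k) →
             (∀ u v → a u v ≡ a v u) → ∀ u v → addAdj a c X u v ≡ addAdj a c X v u
addAdj-sym a c X s zero    zero    = refl
addAdj-sym a c X s zero    (suc v) = refl
addAdj-sym a c X s (suc u) zero    = refl
addAdj-sym a c X s (suc u) (suc v) = s u v

addAdj-irr : ∀ {k n} (a : Fin n → Fin n → Bool) (c : Fin n → Fin k) (X : Subset k) →
             (∀ u → a u u ≡ false) → ∀ u → addAdj a c X u u ≡ false
addAdj-irr a c X i zero    = refl
addAdj-irr a c X i (suc u) = i u

addColor : ∀ {k n} → (Fin n → Fin k) → Fin k → Fin (suc n) → Fin k
addColor c i zero    = i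
addColor c i (suc u) = c u

applyOp : ∀ {k} → CGraph k → Op k → CGraph k
applyOp G (recolor φ) = record { graph = graph G ; color = φ ∘ color G }
applyOp G (addVertex i X) = record
  { graph = record
      { size    = suc (size (graph G))
      ; adj     = addAdj (adj (graph G)) (color G) X
      ; adj-sym = addAdj-sym (adj (graph G)) (color G) X (adj-sym (graph G))
      ; adj-irr = addAdj-irr (adj (graph G)) (color G) X (adj-irr (graph G))
      }
  ; color = addColor (color G) i
  }

run : ∀ {k} → List (Op k) → CGraph k
run ops = foldl applyOp emptyC ops

LinCwAtMost : ℕ → Graph → Set
LinCwAtMost k G = ∃[ k′ ] (k′ ≤ k × ∃[ ops ] (graph (run {k′} ops) ≅ G))

record Derivation (k : ℕ) : Set where
  field
    under   : CGraph k
    profile : Fin (size (graph under)) → Subset k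
    recol   : Fin k → Fin k
open Derivation public

sumAdj : ∀ {k n₁ n₂} → (Fin n₁ → Fin n₁ → Bool) → (Fin n₂ → Fin n₂ → Bool) →
         (Fin n₁ → Fin k) → (Fin n₂ → Subset k) →
         Fin n₁ ⊎ Fin n₂ → Fin n₁ ⊎ Fin n₂ → Bool
sumAdj a₁ a₂ c₁ l₂ (inj₁ u) (inj₁ v) = a₁ u v
sumAdj a₁ a₂ c₁ l₂ (inj₂ u) (inj₂ v) = a₂ u v
sumAdj a₁ a₂ c₁ l₂ (inj₁ u) (inj₂ v) = lookup (l₂ v) (c₁ u)
sumAdj a₁ a₂ c₁ l₂ (inj₂ u) (inj₁ v) = lookup (l₂ u) (c₁ v)

sumAdj-sym : ∀ {k n₁ n₂} (a₁ : Fin n₁ → Fin n₁ → Bool) (a₂ : Fin n₂ → Fin n₂ → Bool)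
             (c₁ : Fin n₁ → Fin k) (l₂ : Fin n₂ → Subset k) →
             (∀ u v → a₁ u v ≡ a₁ v u) → (∀ u v → a₂ u v ≡ a₂ v u) →
             ∀ x y → sumAdj a₁ a₂ c₁ l₂ x y ≡ sumAdj a₁ a₂ c₁ l₂ y x
sumAdj-sym a₁ a₂ c₁ l₂ s₁ s₂ (inj₁ u) (inj₁ v) = s₁ u v
sumAdj-sym a₁ a₂ c₁ l₂ s₁ s₂ (inj₂ u) (inj₂ v) = s₂ u v
sumAdj-sym a₁ a₂ c₁ l₂ s₁ s₂ (inj₁ u) (inj₂ v) = refl
sumAdj-sym a₁ a₂ c₁ l₂ s₁ s₂ (inj₂ u) (inj₁ v) = refl

sumAdj-irr : ∀ {k n₁ n₂} (a₁ : Fin n₁ → Fin n₁ → Bool) (a₂ : Fin n₂ → Fin n₂ → Bool)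
             (c₁ : Fin n₁ → Fin k) (l₂ : Fin n₂ → Subset k) →
             (∀ u → a₁ u u ≡ false) → (∀ u → a₂ u u ≡ false) →
             ∀ x → sumAdj a₁ a₂ c₁ l₂ x x ≡ false
sumAdj-irr a₁ a₂ c₁ l₂ i₁ i₂ (inj₁ u) = i₁ u
sumAdj-irr a₁ a₂ c₁ l₂ i₁ i₂ (inj₂ u) = i₂ u

[_,_]′ : ∀ {n₁ n₂} {A : Set} → (Fin n₁ → A) → (Fin n₂ → A) → Fin n₁ ⊎ Fin n₂ → A
[ f , g ]′ (inj₁ u) = f u
[ f , g ]′ (inj₂ u) = g u

preimage : ∀ {k} → (Fin k → Fin k) → Subset k → Subset k
preimage φ X = tabulate (λ i → lookup X (φ i))

-- Composition σ₁ · σ₂ (vertices of σ₁ first, then vertices of σ₂).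
_·_ : ∀ {k} → Derivation k → Derivation k → Derivation k
_·_ {k} σ₁ σ₂ = record
  { under = record
      { graph = record
          { size    = n₁ + n₂
          ; adj     = λ u v → sumAdj a₁ a₂ c₁ l₂ (splitAt n₁ u) (splitAt n₁ v)
          ; adj-sym = λ u v → sumAdj-sym a₁ a₂ c₁ l₂ (adj-sym G₁) (adj-sym G₂)
                                (splitAt n₁ u) (splitAt n₁ v)
          ; adj-irr = λ u → sumAdj-irr a₁ a₂ c₁ l₂ (adj-irr G₁) (adj-irr G₂) (splitAt n₁ u)
          }
      ; color = λ u → [ recol σ₂ ∘ c₁ , color (under σ₂) ]′ (splitAt n₁ u)
      }
  ; profile = λ u → [ profile σ₁ , (λ v → preimage (recol σ₁) (l₂ v)) ]′ (splitAt n₁ u)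
  ; recol   = recol σ₂ ∘ recol σ₁
  }
  where
  G₁ = graph (under σ₁)
  G₂ = graph (under σ₂)
  n₁ = size G₁
  n₂ = size G₂
  a₁ = adj G₁
  a₂ = adj G₂
  c₁ = color (under σ₁)
  l₂ = profile σ₂

Atomic : ∀ {k} → Derivation k → Set
Atomic σ = size (graph (under σ)) ≤ 1

data InS {k : ℕ} : Derivation k → Set where
  atom : ∀ {σ} → Atomic σ → InS σ
  comp : ∀ {σ₁ σ₂} → InS σ₁ → InS σ₂ → InS (σ₁ · σ₂)

module Submission where

-- A linear clique-width expression is simulated step by step by an
-- iterated composition of atomic derivations.
--
-- The colours [k′] are embedded into [k] by inject≤;
-- recolourings and colour sets are lifted along that embedding.  We keep
-- the invariant "σ ∈ S_k simulates the coloured graph H built so far":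
-- there is an isomorphism between H and the underlying graph of σ under
-- which colours agree up to the embedding.  The invariant holds for the
-- empty graph and the empty derivation, and it is preserved by
--   * Recolor φ,    via composing σ with the empty derivation recolouring by φ;
--   * Add Vertex i X, via composing σ with the one-vertex derivation of
--     colour i and profile X.

open import Defs
open import Data.Nat using (ℕ; suc; _+_; _≤_; z≤n; s≤s)
open import Data.Product using (∃-syntax; _×_; _,_)
open import Data.Fin using (Fin; zero; suc; splitAt; _↑ˡ_; _↑ʳ_; inject≤)
open import Data.Fin.Properties using (splitAt-↑ˡ; splitAt-↑ʳ; splitAt⁻¹-↑ˡ; splitAt⁻¹-↑ʳ)
open import Data.Fin.Subset using (Subset)
open import Data.Maybe using (Maybe; just; nothing)
import Data.Maybe as Maybe
open import Data.Bool using (Bool; false)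
open import Data.Vec using (lookup; tabulate)
open import Data.Vec.Properties using (lookup∘tabulate)
open import Data.Sum using (inj₁; inj₂)
open import Data.List using (List; []; _∷_; foldl)
open import Function using (_∘_; id)
open import Function.Bundles using (Bijection; mk↔ₛ′)
open import Function.Properties.Inverse using (↔⇒⤖)
open import Function.Construct.Composition using (_⤖-∘_)
open import Relation.Binary.PropositionalEquality
open ≡-Reasoning

-- Partial inverse of the inclusion λ i → inject≤ i p, by recursion on p : a ≤ b.
project : ∀ {a b} → a ≤ b → Fin b → Maybe (Fin a)
project z≤n     j       = nothing
project (s≤s p) zero    = just zero
project (s≤s p) (suc j) = Maybe.map suc (project p j)

project-inject≤ : ∀ {a b} (p : a ≤ b) (i : Fin a) → project p (inject≤ i p) ≡ just i
project-inject≤ (s≤s p) zero    = refl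
project-inject≤ (s≤s p) (suc i) = cong (Maybe.map suc) (project-inject≤ p i)

-- Colours outside
-- the image are left fixed by lifted recolourings and belong to no
-- lifted colour set.
module ColourEmbedding {k′ k : ℕ} (k′≤k : k′ ≤ k) where

  embed : Fin k′ → Fin k
  embed i = inject≤ i k′≤k

  liftRecolour : (Fin k′ → Fin k′) → Fin k → Fin k
  liftRecolour φ j = Maybe.maybe (embed ∘ φ) j (project k′≤k j)

  liftRecolour-embed : ∀ φ i → liftRecolour φ (embed i) ≡ embed (φ i)
  liftRecolour-embed φ i = cong (Maybe.maybe (embed ∘ φ) (embed i)) (project-inject≤ k′≤k i)

  liftSubset : Subset k′ → Subset k
  liftSubset X = tabulate (λ j → Maybe.maybe (lookup X) false (project k′≤k j))

  liftSubset-embed : ∀ X i → lookup (liftSubset X) (embed i) ≡ lookup X i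
  liftSubset-embed X i = begin
    lookup (liftSubset X) (embed i)                         ≡⟨ lookup∘tabulate _ (embed i) ⟩
    Maybe.maybe (lookup X) false (project k′≤k (embed i))   ≡⟨ cong (Maybe.maybe (lookup X) false) (project-inject≤ k′≤k i) ⟩
    lookup X i                                              ∎

vertices : ∀ {k} → Derivation k → ℕ
vertices σ = size (graph (under σ))

adjD : ∀ {k} (σ : Derivation k) → Fin (vertices σ) → Fin (vertices σ) → Bool
adjD σ = adj (graph (under σ))

colourD : ∀ {k} (σ : Derivation k) → Fin (vertices σ) → Fin k
colourD σ = color (under σ)

module Composition {k : ℕ} (σ τ : Derivation k) where
  private
    n = vertices σ
    m = vertices τ

  adj-ˡˡ : ∀ u v → adjD (σ · τ) (u ↑ˡ m) (v ↑ˡ m) ≡ adjD σ u v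
  adj-ˡˡ u v rewrite splitAt-↑ˡ n u m | splitAt-↑ˡ n v m = refl

  adj-ˡʳ : ∀ u w → adjD (σ · τ) (u ↑ˡ m) (n ↑ʳ w) ≡ lookup (profile τ w) (colourD σ u)
  adj-ˡʳ u w rewrite splitAt-↑ˡ n u m | splitAt-↑ʳ n m w = refl

  adj-ʳˡ : ∀ w u → adjD (σ · τ) (n ↑ʳ w) (u ↑ˡ m) ≡ lookup (profile τ w) (colourD σ u)
  adj-ʳˡ w u rewrite splitAt-↑ˡ n u m | splitAt-↑ʳ n m w = refl

  adj-ʳʳ : ∀ w x → adjD (σ · τ) (n ↑ʳ w) (n ↑ʳ x) ≡ adjD τ w x
  adj-ʳʳ w x rewrite splitAt-↑ʳ n m w | splitAt-↑ʳ n m x = refl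

  colour-ˡ : ∀ u → colourD (σ · τ) (u ↑ˡ m) ≡ recol τ (colourD σ u)
  colour-ˡ u rewrite splitAt-↑ˡ n u m = refl

  colour-ʳ : ∀ w → colourD (σ · τ) (n ↑ʳ w) ≡ colourD τ w
  colour-ʳ w rewrite splitAt-↑ʳ n m w = refl

pureRecolouring : ∀ {k} → (Fin k → Fin k) → Derivation k
pureRecolouring φ = record { under = emptyC ; profile = λ () ; recol = φ }

singleVertexGraph : Graph
singleVertexGraph = record
  { size = 1 ; adj = λ _ _ → false ; adj-sym = λ _ _ → refl ; adj-irr = λ _ → refl }

singleVertex : ∀ {k} → Fin k → Subset k → Derivation k
singleVertex i X = record
  { under = record { graph = singleVertexGraph ; color = λ _ → i }
  ; profile = λ _ → X
  ; recol = id
  }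

record Simulates {k′ k : ℕ} (k′≤k : k′ ≤ k) (σ : Derivation k) (H : CGraph k′) : Set where
  open ColourEmbedding k′≤k using (embed)
  field
    generated : InS σ
    to        : Fin (size (graph H)) → Fin (vertices σ)
    from      : Fin (vertices σ) → Fin (size (graph H))
    from∘to   : ∀ u → from (to u) ≡ u
    to∘from   : ∀ w → to (from w) ≡ w
    adj-to    : ∀ u v → adjD σ (to u) (to v) ≡ adj (graph H) u v
    colour-to : ∀ u → colourD σ (to u) ≡ embed (color H u)
open Simulates

-- Fin (n + 0) is a copy of Fin n: all vertices of σ · τ come from σ when
-- τ has no vertices.
dropEmpty : ∀ n → Fin (n + 0) → Fin n
dropEmpty n w with splitAt n w
... | inj₁ u = u

dropEmpty-↑ˡ : ∀ n u → dropEmpty n (u ↑ˡ 0) ≡ u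
dropEmpty-↑ˡ n u rewrite splitAt-↑ˡ n u 0 = refl

↑ˡ-dropEmpty : ∀ n w → dropEmpty n w ↑ˡ 0 ≡ w
↑ˡ-dropEmpty n w with splitAt n w in eq
... | inj₁ u = splitAt⁻¹-↑ˡ eq

module Simulation {k′ k : ℕ} (k′≤k : k′ ≤ k) where
  open ColourEmbedding k′≤k

  simulate-empty : Simulates k′≤k (pureRecolouring id) emptyC
  simulate-empty = record
    { generated = atom z≤n
    ; to = λ () ; from = λ () ; from∘to = λ () ; to∘from = λ ()
    ; adj-to = λ () ; colour-to = λ ()
    }

  simulate-recolour : ∀ {σ H} φ → Simulates k′≤k σ H →
                      Simulates k′≤k (σ · pureRecolouring (liftRecolour φ)) (applyOp H (recolor φ))
  simulate-recolour {σ} {H} φ s = record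
    { generated = comp {σ₂ = τ} (generated s) (atom z≤n)
    ; to        = λ u → to s u ↑ˡ 0
    ; from      = from s ∘ dropEmpty n
    ; from∘to   = λ u → trans (cong (from s) (dropEmpty-↑ˡ n (to s u))) (from∘to s u)
    ; to∘from   = λ w → trans (cong (_↑ˡ 0) (to∘from s (dropEmpty n w))) (↑ˡ-dropEmpty n w)
    ; adj-to    = λ u v → trans (adj-ˡˡ (to s u) (to s v)) (adj-to s u v)
    ; colour-to = colour-to′
    }
    where
    τ = pureRecolouring (liftRecolour φ)
    n = vertices σ
    open Composition σ τ

    colour-to′ : ∀ u → colourD (σ · τ) (to s u ↑ˡ 0) ≡ embed (φ (color H u))
    colour-to′ u = begin
      colourD (σ · τ) (to s u ↑ˡ 0)      ≡⟨ colour-ˡ (to s u) ⟩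
      liftRecolour φ (colourD σ (to s u)) ≡⟨ cong (liftRecolour φ) (colour-to s u) ⟩
      liftRecolour φ (embed (color H u))  ≡⟨ liftRecolour-embed φ (color H u) ⟩
      embed (φ (color H u))               ∎

  simulate-addVertex : ∀ {σ H} i X → Simulates k′≤k σ H →
                       Simulates k′≤k (σ · singleVertex (embed i) (liftSubset X))
                                      (applyOp H (addVertex i X))
  simulate-addVertex {σ} {H} i X s = record
    { generated = comp {σ₂ = τ} (generated s) (atom (s≤s z≤n))
    ; to        = to′
    ; from      = from′
    ; from∘to   = from∘to′
    ; to∘from   = to∘from′
    ; adj-to    = adj-to′
    ; colour-to = colour-to′
    }
    where
    τ = singleVertex (embed i) (liftSubset X)
    n = vertices σ
    open Composition σ τ
    H′ = applyOp H (addVertex i X)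

    to′ : Fin (suc (size (graph H))) → Fin (n + 1)
    to′ zero    = n ↑ʳ zero
    to′ (suc u) = to s u ↑ˡ 1

    from′ : Fin (n + 1) → Fin (suc (size (graph H)))
    from′ w with splitAt n w
    ... | inj₁ v = suc (from s v)
    ... | inj₂ _ = zero

    from∘to′ : ∀ u → from′ (to′ u) ≡ u
    from∘to′ zero    rewrite splitAt-↑ʳ n 1 zero    = refl
    from∘to′ (suc u) rewrite splitAt-↑ˡ n (to s u) 1 = cong suc (from∘to s u)

    to∘from′ : ∀ w → to′ (from′ w) ≡ w
    to∘from′ w with splitAt n w in eq
    ... | inj₁ v    = trans (cong (_↑ˡ 1) (to∘from s v)) (splitAt⁻¹-↑ˡ eq)
    ... | inj₂ zero = splitAt⁻¹-↑ʳ eq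

    new-adj : ∀ u → lookup (liftSubset X) (colourD σ (to s u)) ≡ lookup X (color H u)
    new-adj u = trans (cong (lookup (liftSubset X)) (colour-to s u)) (liftSubset-embed X (color H u))

    adj-to′ : ∀ u v → adjD (σ · τ) (to′ u) (to′ v) ≡ adj (graph H′) u v
    adj-to′ zero    zero    = adj-ʳʳ zero zero
    adj-to′ zero    (suc v) = trans (adj-ʳˡ zero (to s v)) (new-adj v)
    adj-to′ (suc u) zero    = trans (adj-ˡʳ (to s u) zero) (new-adj u)
    adj-to′ (suc u) (suc v) = trans (adj-ˡˡ (to s u) (to s v)) (adj-to s u v)

    colour-to′ : ∀ u → colourD (σ · τ) (to′ u) ≡ embed (color H′ u)
    colour-to′ zero    = colour-ʳ zero
    colour-to′ (suc u) = trans (colour-ˡ (to s u)) (colour-to s u)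

  simulate-run : ∀ {σ H} (ops : List (Op k′)) → Simulates k′≤k σ H →
                 ∃[ σ′ ] Simulates k′≤k σ′ (foldl applyOp H ops)
  simulate-run []                    s = _ , s
  simulate-run (recolor φ ∷ ops)     s = simulate-run ops (simulate-recolour φ s)
  simulate-run (addVertex i X ∷ ops) s = simulate-run ops (simulate-addVertex i X s)

simulation⇒≅ : ∀ {k′ k} {k′≤k : k′ ≤ k} {σ H} → Simulates k′≤k σ H → graph (under σ) ≅ graph H
simulation⇒≅ {σ = σ} {H} s = bijection , adj-from
  where
  bijection = ↔⇒⤖ (mk↔ₛ′ (from s) (to s) (from∘to s) (to∘from s))

  adj-from : ∀ w x → adj (graph H) (from s w) (from s x) ≡ adjD σ w x
  adj-from w x = begin
    adj (graph H) (from s w) (from s x)      ≡⟨ adj-to s (from s w) (from s x) ⟨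
    adjD σ (to s (from s w)) (to s (from s x)) ≡⟨ cong₂ (adjD σ) (to∘from s w) (to∘from s x) ⟩
    adjD σ w x                               ∎

mainTheorem3 : (k : ℕ) (G : Graph) → LinCwAtMost k G →
    ∃[ σ ] (InS {k} σ × (graph (under σ) ≅ G))
mainTheorem3 k G (k′ , k′≤k , ops , runOps≅G , runOps-adj) =
  let open Simulation k′≤k
      σ , s = simulate-run ops simulate-empty
      f , f-adj = simulation⇒≅ s
  in σ , generated s , (runOps≅G ⤖-∘ f) ,
     λ u v → trans (runOps-adj (Bijection.to f u) (Bijection.to f v)) (f-adj u v)
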